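{- Fix a state interpretation $\mathcal{I}$, a set of domain formulas $\mathbf{K}$, and a compatible pair $(\mu,\hat{\mu})$ w.r.t. $\mathcal{I}$ and $\mathbf{K}$. The rule (lift-var), which has no premises and the conclusion $\mathbf{C},\mathbf{K}\vdash\langle\!\langle\hat{\mu}(\Phi[\mathtt{v}\setminus\mathtt{expr}])\mid\Phi[\mathtt{v}\setminus\mathtt{expr}]\rangle\!\rangle\;\mathtt{v}:=\mathtt{expr}\;\langle\!\langle\hat{\mu}(\Phi)\mid\Phi\rangle\!\rangle$ (for any set of contracts $\mathbf{C}$, variable $\mathtt{v}$, expression $\mathtt{expr}$ and state formula $\Phi$), is sound; i.e. every such judgement is valid.
   Context: Values are $\mathsf{Val}=\mathbb{Z}\cup\nabla$ ($\nabla$ a set of names). A program state is $\sigma:\mathtt{V}\to\mathsf{Val}$ for program variables $\mathtt{V}$; $\mathtt{S}$ is the set of states. State formulas: $\Phi ::= \Phi\wedge\Phi\mid\neg\Phi\mid t\doteq t\mid p(\overline{t})$, $t ::= v\mid x\mid f(\overline{t})$; $\sigma,\mathcal{I}\models\Phi$ is usual first-order satisfaction with variables evaluated by $\sigma$; $\Phi[\mathtt{v}\setminus\mathtt{e}]$ is substitution. Domain formulas are DL axioms $\delta ::= C\sqsubseteq C\mid C(o)\mid R(o,o)\mid R(o,n)$ over nominals, abstract roles, concrete integer roles and atomic concepts, concepts $C ::= \top\mid\bot\mid A\mid\neg C\mid C\sqcup C\mid C\sqcap C\mid\exists R.C\mid\forall R.C\mid\exists T.n\mid\forall T.n$, with standard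 semantics. $\Delta\models^\mathbf{K}\Delta'$ (also $\models_\mathbf{K}$) means every domain interpretation satisfying $\Delta$ and $\mathbf{K}$ satisfies $\Delta'$. A state lifting $\mu$ maps states (with fixed $\mathcal{I}$) to domain interpretations; a specification lifting $\hat{\mu}$ maps state formulas to sets of domain formulas. $(\mu,\hat{\mu})$ is compatible w.r.t. $\mathcal{I},\mathbf{K}$ iff $\sigma,\mathcal{I}\models\Phi$ implies $\mu(\sigma)\models_\mathbf{K}\hat{\mu}(\Phi)$ for all $\sigma,\Phi$. A two-tier assertion $\langle\!\langle\Delta\mid\Phi\rangle\!\rangle$ pairs a set of domain formulas with a state formula; $\sigma\models_\mathbf{K}\langle\!\langle\Delta\mid\Phi\rangle\!\rangle$ iff $\sigma,\mathcal{I}\models\Phi$ and $\mu(\sigma),\hat{\mu}(\Phi)\models^\mathbf{K}\Delta$. Statements of the language include assignments $\mathtt{v}:=\mathsf{expr}$ with $\mathsf{expr} ::= n\mid\mathtt{v}$ and semantics $[\![\mathtt{v}:=\mathsf{expr}]\!]_{\mathbf{C},\mathbf{K}}=\{(\sigma,\sigma[\mathtt{v}\mapsto[\![\mathsf{expr}]\!]_\sigma])\mid\sigma\in\mathtt{S}\}$, where $\mathbf{C}$ is a set of procedure contracts (pairs of two-tier assertions). A judgement $\mathbf{C},\mathbf{K}\vdash\langle\!\langle\Delta_1\mid\Phi_1\rangle\!\rangle\, s\,\langle\!\langle\Delta_2\mid\Phi_2\rangle\!\rangle$ is valid iff for all $(\sigma,\sigma')\in[\![s]\!]_{\mathbf{C},\mathbf{K}}$,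 $\sigma\models_\mathbf{K}\langle\!\langle\Delta_1\mid\Phi_1\rangle\!\rangle$ implies $\sigma'\models_\mathbf{K}\langle\!\langle\Delta_2\mid\Phi_2\rangle\!\rangle$. -}

module Defs where

open import Data.Integer using (ℤ)
open import Data.Nat using (ℕ)
open import Data.Sum using (_⊎_; inj₁)
open import Data.Product using (_×_; Σ; ∃)
open import Data.Vec using (Vec; []; _∷_)
open import Relation.Nullary using (¬_; yes; no)
open import Relation.Binary.Definitions using (DecidableEquality)
open import Relation.Binary.PropositionalEquality using (_≡_)

-- A signature fixing all the "sets of symbols" the paper leaves abstract.
record Sig : Set₁ where
  field
    Name    : Set
    PVar    : Set
    _≟v_    : DecidableEquality PVar   -- needed for state update σ[v ↦ a]
    LVar    : Set
    Fun     : Set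
    fArity  : Fun → ℕ
    Pred    : Set
    pArity  : Pred → ℕ
    Nom     : Set
    ARole   : Set
    CRole   : Set
    AConc   : Set

module Lang (S : Sig) where
  open Sig S

  Val : Set
  Val = ℤ ⊎ Name

  State : Set
  State = PVar → Val

  _[_↦_] : State → PVar → Val → State
  (σ [ v ↦ a ]) w with w ≟v v
  ... | yes _ = a
  ... | no  _ = σ w

  data Term : Set where
    pvar : PVar → Term
    lvar : LVar → Term
    lit  : ℤ → Term          -- integer literals (needed to substitute v ∖ n)
    fun  : (f : Fun) → Vec Term (fArity f) → Term

  data Formula : Set where
    _∧_  : Formula → Formula → Formula
    ¬'_  : Formula → Formula
    _≐_  : Term → Term → Formula
    pred : (p : Pred) → Vec Term (pArity p) → Formula

  record StateInterp : Set₁ where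
    field
      funI  : (f : Fun) → Vec Val (fArity f) → Val
      predI : (p : Pred) → Vec Val (pArity p) → Set
      lvarI : LVar → Val

  module _ (𝓘 : StateInterp) where
    open StateInterp 𝓘

    mutual
      evalT : State → Term → Val
      evalT σ (pvar v)   = σ v
      evalT σ (lvar x)   = lvarI x
      evalT σ (lit n)    = inj₁ n
      evalT σ (fun f ts) = funI f (evalTs σ ts)

      evalTs : ∀ {n} → State → Vec Term n → Vec Val n
      evalTs σ []       = []
      evalTs σ (t ∷ ts) = evalT σ t ∷ evalTs σ ts

    sat : State → Formula → Set
    sat σ (Φ ∧ Ψ)     = sat σ Φ × sat σ Ψ
    sat σ (¬' Φ)      = ¬ sat σ Φ
    sat σ (t ≐ u)     = evalT σ t ≡ evalT σ u
    sat σ (pred p ts) = predI p (evalTs σ ts)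

  data Expr : Set where
    num : ℤ → Expr
    var : PVar → Expr

  exprTerm : Expr → Term
  exprTerm (num n) = lit n
  exprTerm (var v) = pvar v

  ⟦_⟧e_ : Expr → State → Val
  ⟦ num n ⟧e σ = inj₁ n
  ⟦ var v ⟧e σ = σ v

  mutual
    substT : Term → PVar → Term → Term
    substT (pvar w) v e with w ≟v v
    ... | yes _ = e
    ... | no  _ = pvar w
    substT (lvar x)   v e = lvar x
    substT (lit n)    v e = lit n
    substT (fun f ts) v e = fun f (substTs ts v e)

    substTs : ∀ {n} → Vec Term n → PVar → Term → Vec Term n
    substTs []       v e = []
    substTs (t ∷ ts) v e = substT t v e ∷ substTs ts v e

  _[_∖_] : Formula → PVar → Expr → Formula
  (Φ ∧ Ψ)     [ v ∖ e ] = (Φ [ v ∖ e ]) ∧ (Ψ [ v ∖ e ])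
  (¬' Φ)      [ v ∖ e ] = ¬' (Φ [ v ∖ e ])
  (t ≐ u)     [ v ∖ e ] = substT t v (exprTerm e) ≐ substT u v (exprTerm e)
  (pred p ts) [ v ∖ e ] = pred p (substTs ts v (exprTerm e))

  data Concept : Set where
    ⊤c ⊥c : Concept
    atom  : AConc → Concept
    ¬c_   : Concept → Concept
    _⊔_ _⊓_ : Concept → Concept → Concept
    ∃R ∀R : ARole → Concept → Concept
    ∃T ∀T : CRole → ℤ → Concept

  data DFormula : Set where
    _⊑_   : Concept → Concept → DFormula
    cassert : Concept → Nom → DFormula
    rassert : ARole → Nom → Nom → DFormula
    tassert : CRole → Nom → ℤ → DFormula

  DSet : Set₁
  DSet = DFormula → Set

  record DomInterp : Set₁ where
    field
      Dom   : Set
      nomI  : Nom → Dom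
      concI : AConc → Dom → Set
      aroleI : ARole → Dom → Dom → Set
      croleI : CRole → Dom → ℤ → Set

  module _ (M : DomInterp) where
    open DomInterp M

    ⟦_⟧c : Concept → Dom → Set
    ⟦ ⊤c ⟧c d      = Data.Unit.⊤ where import Data.Unit
    ⟦ ⊥c ⟧c d      = Data.Empty.⊥ where import Data.Empty
    ⟦ atom A ⟧c d  = concI A d
    ⟦ ¬c C ⟧c d    = ¬ ⟦ C ⟧c d
    ⟦ C ⊔ D ⟧c d   = ⟦ C ⟧c d ⊎ ⟦ D ⟧c d
    ⟦ C ⊓ D ⟧c d   = ⟦ C ⟧c d × ⟦ D ⟧c d
    ⟦ ∃R R C ⟧c d  = Σ Dom (λ d' → aroleI R d d' × ⟦ C ⟧c d')
    ⟦ ∀R R C ⟧c d  = (d' : Dom) → aroleI R d d' → ⟦ C ⟧c d'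
    ⟦ ∃T T n ⟧c d  = croleI T d n
    ⟦ ∀T T n ⟧c d  = (m : ℤ) → croleI T d m → m ≡ n

    ⊨δ : DFormula → Set
    ⊨δ (C ⊑ D)         = (d : Dom) → ⟦ C ⟧c d → ⟦ D ⟧c d
    ⊨δ (cassert C o)   = ⟦ C ⟧c (nomI o)
    ⊨δ (rassert R o o') = aroleI R (nomI o) (nomI o')
    ⊨δ (tassert T o n) = croleI T (nomI o) n

    ⊨Δ : DSet → Set
    ⊨Δ Δ = (δ : DFormula) → Δ δ → ⊨δ δ

  _⊨[_]_ : DSet → DSet → DSet → Set₁
  Δ ⊨[ K ] Δ' = (M : DomInterp) → ⊨Δ M Δ → ⊨Δ M K → ⊨Δ M Δ'

  _⊨K[_]_ : DomInterp → DSet → DSet → Set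
  M ⊨K[ K ] Δ = ⊨Δ M K → ⊨Δ M Δ

  _,_⊨K[_]_ : DomInterp → DSet → DSet → DSet → Set
  M , Δ' ⊨K[ K ] Δ = ⊨Δ M K → ⊨Δ M Δ' → ⊨Δ M Δ

  Compatible : StateInterp → DSet → (State → DomInterp) → (Formula → DSet) → Set
  Compatible 𝓘 K μ μ̂ = (σ : State) (Φ : Formula) → sat 𝓘 σ Φ → μ σ ⊨K[ K ] μ̂ Φ

  record TwoTier : Set₁ where
    constructor ⟪_∣_⟫
    field
      dpart : DSet
      spart : Formula

  satTT : StateInterp → DSet → (State → DomInterp) → (Formula → DSet)
        → State → TwoTier → Set
  satTT 𝓘 K μ μ̂ σ ⟪ Δ ∣ Φ ⟫ = sat 𝓘 σ Φ × (μ σ , μ̂ Φ ⊨K[ K ] Δ)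

  Contracts : Set₂
  Contracts = TwoTier × TwoTier → Set₁

  assignSem : Contracts → DSet → PVar → Expr → State → State → Set
  assignSem C K v e σ σ' = σ' ≡ σ [ v ↦ ⟦ e ⟧e σ ]

  Valid : StateInterp → DSet → (State → DomInterp) → (Formula → DSet)
        → (State → State → Set) → TwoTier → TwoTier → Set
  Valid 𝓘 K μ μ̂ sem pre post =
    (σ σ' : State) → sem σ σ' → satTT 𝓘 K μ μ̂ σ pre → satTT 𝓘 K μ μ̂ σ' post

-- Evaluating a formula after substituting e for v is evaluating it in the
-- state updated at v by the value of e (the substitution lemma), so the
-- state part of the precondition becomes the state part of the
-- postcondition. The domain part of the postcondition, μ̂ Φ, is entailed
-- by μ̂ Φ itself.
module Submission where

open import Defs
open import Data.Product using (_,_)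
open import Data.Vec using (Vec; []; _∷_)
open import Function using (_∘_; _⇔_; mk⇔; module Equivalence)
open import Relation.Nullary using (yes; no)
open import Relation.Binary.PropositionalEquality
  using (_≡_; refl; sym; trans; cong; cong₂; subst)

module Substitution (S : Sig) where
  open Sig S
  open Lang S
  open Equivalence using (to; from)

  evalT-exprTerm : ∀ 𝓘 σ (e : Expr) → evalT 𝓘 σ (exprTerm e) ≡ ⟦ e ⟧e σ
  evalT-exprTerm 𝓘 σ (num n) = refl
  evalT-exprTerm 𝓘 σ (var w) = refl

  module _ (𝓘 : StateInterp) (σ : State) (v : PVar) (u : Term) where

    mutual
      evalT-substT : ∀ t → evalT 𝓘 σ (substT t v u) ≡ evalT 𝓘 (σ [ v ↦ evalT 𝓘 σ u ]) t
      evalT-substT (pvar w) with w ≟v v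
      ... | yes _ = refl
      ... | no  _ = refl
      evalT-substT (lvar x)   = refl
      evalT-substT (lit n)    = refl
      evalT-substT (fun f ts) = cong (StateInterp.funI 𝓘 f) (evalTs-substTs ts)

      evalTs-substTs : ∀ {n} (ts : Vec Term n) →
        evalTs 𝓘 σ (substTs ts v u) ≡ evalTs 𝓘 (σ [ v ↦ evalT 𝓘 σ u ]) ts
      evalTs-substTs []       = refl
      evalTs-substTs (t ∷ ts) = cong₂ _∷_ (evalT-substT t) (evalTs-substTs ts)

  module _ (𝓘 : StateInterp) (σ : State) (v : PVar) (e : Expr) where

    private
      σ′ : State
      σ′ = σ [ v ↦ ⟦ e ⟧e σ ]

      evalT-subst : ∀ t → evalT 𝓘 σ (substT t v (exprTerm e)) ≡ evalT 𝓘 σ′ t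
      evalT-subst t
        rewrite evalT-substT 𝓘 σ v (exprTerm e) t | evalT-exprTerm 𝓘 σ e = refl

      evalTs-subst : ∀ {n} (ts : Vec Term n) →
        evalTs 𝓘 σ (substTs ts v (exprTerm e)) ≡ evalTs 𝓘 σ′ ts
      evalTs-subst ts
        rewrite evalTs-substTs 𝓘 σ v (exprTerm e) ts | evalT-exprTerm 𝓘 σ e = refl

    -- Both directions are needed because negation flips them.
    sat-subst : ∀ Φ → sat 𝓘 σ (Φ [ v ∖ e ]) ⇔ sat 𝓘 σ′ Φ
    sat-subst (Φ ∧ Ψ) = mk⇔
      (λ (p , q) → to   (sat-subst Φ) p , to   (sat-subst Ψ) q)
      (λ (p , q) → from (sat-subst Φ) p , from (sat-subst Ψ) q)
    sat-subst (¬' Φ) = mk⇔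
      (λ ¬p → ¬p ∘ from (sat-subst Φ))
      (λ ¬p → ¬p ∘ to   (sat-subst Φ))
    sat-subst (t ≐ u) = mk⇔
      (λ p → trans (sym (evalT-subst t)) (trans p (evalT-subst u)))
      (λ p → trans (evalT-subst t) (trans p (sym (evalT-subst u))))
    sat-subst (pred p ts) = mk⇔
      (subst (StateInterp.predI 𝓘 p) (evalTs-subst ts))
      (subst (StateInterp.predI 𝓘 p) (sym (evalTs-subst ts)))

  ⊨K-refl : ∀ {M K Δ} → _,_⊨K[_]_ M Δ K Δ
  ⊨K-refl _ ⊨Δ = ⊨Δ

open Substitution using (sat-subst; ⊨K-refl)

proposition1 : (S : Sig) → let open Lang S in
    (𝓘 : StateInterp) (K : DSet) (μ : State → DomInterp) (μ̂ : Formula → DSet)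
    → Compatible 𝓘 K μ μ̂
    → (C : Contracts) (v : Sig.PVar S) (e : Expr) (Φ : Formula)
    → Valid 𝓘 K μ μ̂ (assignSem C K v e)
        ⟪ μ̂ (Φ [ v ∖ e ]) ∣ Φ [ v ∖ e ] ⟫
        ⟪ μ̂ Φ ∣ Φ ⟫
proposition1 S 𝓘 K μ μ̂ _ C v e Φ σ _ refl (σ⊨Φ[v∖e] , _) =
  Equivalence.to (sat-subst S 𝓘 σ v e Φ) σ⊨Φ[v∖e] , ⊨K-refl S
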